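{- Let $(S_n)_{n\ge0}$ be defined by $S_0=3$, $S_1=1$, $S_2=3$ and $S_{n+1}=S_n+S_{n-1}+S_{n-2}$ for $n\ge2$. Let $\alpha,\beta,\gamma$ be the roots of $x^3-x^2-x-1=0$ and $C_n=\alpha^n\beta^n+\alpha^n\gamma^n+\beta^n\gamma^n$ for $n\ge0$. Then for all integers $n\ge m\ge 0$, $$S_nS_{n+m}=S_{2n+m}+S_mC_n-C_{n-m}.$$
   Context: $S_n$ is the generalized Tribonacci (Tribonacci–Lucas) sequence; it satisfies $S_n=\alpha^n+\beta^n+\gamma^n$. The roots satisfy $\alpha+\beta+\gamma=1$, $\alpha\beta+\alpha\gamma+\beta\gamma=-1$, $\alpha\beta\gamma=1$. -}

module Defs where

open import Level using (Level)
open import Data.Nat using (ℕ; zero; suc)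
open import Algebra.Bundles using (CommutativeRing)

module Tribonacci {c ℓ : Level} (R : CommutativeRing c ℓ) where
  open CommutativeRing R

  pow : Carrier → ℕ → Carrier
  pow x zero    = 1#
  pow x (suc n) = x * pow x n

  S : ℕ → Carrier
  S zero                   = 1# + 1# + 1#
  S (suc zero)             = 1#
  S (suc (suc zero))       = 1# + 1# + 1#
  S (suc (suc (suc n)))    = S (suc (suc n)) + S (suc n) + S n

  C : Carrier → Carrier → Carrier → ℕ → Carrier
  C α β γ n = pow α n * pow β n + pow α n * pow γ n + pow β n * pow γ n

{-# OPTIONS --safe #-}
module Submission where

-- Put n = m + k and, for the roots x₁, x₂, x₃, uᵢ = xᵢⁿ and aᵢ = xᵢᵐ, so that uᵢ = aᵢ xᵢᵏ. Then
--   (Σ uᵢ)(Σ uᵢaᵢ) = Σ uᵢ²aᵢ + Σ_{i≠j} uᵢuⱼaⱼ,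
--   (Σ aₗ)(Σ_{i<j} uᵢuⱼ) = Σ_{i≠j} uᵢuⱼaⱼ + Σ_{i<j} uᵢuⱼaₗ   (l the remaining index),
-- and uᵢuⱼaₗ = (x₁x₂x₃)ᵐ (xᵢxⱼ)ᵏ, so the last sum is (αβγ)ᵐ Cₖ = Cₖ. Apart from αβγ = 1,
-- this is a polynomial identity in the xᵢᵐ and xᵢᵏ; the hypotheses on the symmetric functions
-- serve to identify S with the power sums αⁿ + βⁿ + γⁿ, both being Tribonacci sequences with
-- the same first three terms.

open import Defs
open import Level using (Level)
open import Data.Nat using (ℕ; zero; suc; _≤_; _∸_) renaming (_+_ to _+ℕ_; _*_ to _*ℕ_)
open import Algebra.Bundles using (CommutativeRing)
import Data.Nat.Properties as ℕₚ
open import Data.Product using (_,_)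
open import Relation.Binary.PropositionalEquality as ≡ using (_≡_)
import Algebra.Properties.CommutativeSemiring.Exp as Exp
import Algebra.Properties.Group as GroupProperties
import Algebra.Properties.Ring as RingProperties
import Algebra.Solver.Ring.NaturalCoefficients.Default as SemiringSolver
import Relation.Binary.Reasoning.Setoid as SetoidReasoning

module TribonacciIdentities {c ℓ : Level} (R : CommutativeRing c ℓ) where
  open CommutativeRing R
  open Tribonacci R
  open Exp commutativeSemiring using (_^_; ^-homo-*; ^-congˡ; ^-distrib-*)
  open GroupProperties +-group using (//-rightDividesʳ)
  open RingProperties ring using (-1*x≈-x)
  -- The solver works over commutative semirings, so every identity given to it is stated
  -- without subtraction; the hypothesis e₂ ≈ - 1# enters only through x≈[x+e₂y]+y.
  open SemiringSolver commutativeSemiring using (solve; _:=_; _:+_; _:*_; con)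
  open SetoidReasoning setoid

  pow≡^ : ∀ x n → pow x n ≡ x ^ n
  pow≡^ x zero    = ≡.refl
  pow≡^ x (suc n) = ≡.cong (x *_) (pow≡^ x n)

  pow-+ : ∀ x m n → pow x (m +ℕ n) ≈ pow x m * pow x n
  pow-+ x m n rewrite pow≡^ x (m +ℕ n) | pow≡^ x m | pow≡^ x n = ^-homo-* x m n

  pow-distrib-* : ∀ x y n → pow (x * y) n ≈ pow x n * pow y n
  pow-distrib-* x y n rewrite pow≡^ (x * y) n | pow≡^ x n | pow≡^ y n = ^-distrib-* x y n

  pow-congˡ : ∀ {x y} n → x ≈ y → pow x n ≈ pow y n
  pow-congˡ {x} {y} n x≈y rewrite pow≡^ x n | pow≡^ y n = ^-congˡ n x≈y

  pow-1# : ∀ n → pow 1# n ≈ 1#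
  pow-1# zero    = refl
  pow-1# (suc n) = trans (*-identityˡ (pow 1# n)) (pow-1# n)

  x+z≈y⇒x≈y-z : ∀ {x y z} → x + z ≈ y → x ≈ y - z
  x+z≈y⇒x≈y-z {x} {y} {z} x+z≈y = begin
    x           ≈⟨ //-rightDividesʳ z x ⟨
    (x + z) - z ≈⟨ +-congʳ x+z≈y ⟩
    y - z       ∎

  IsTribonacci : (ℕ → Carrier) → Set ℓ
  IsTribonacci f = ∀ n → f (suc (suc (suc n))) ≈ f (suc (suc n)) + f (suc n) + f n

  S-isTribonacci : IsTribonacci S
  S-isTribonacci n = refl

  +-isTribonacci : ∀ {f g} → IsTribonacci f → IsTribonacci g → IsTribonacci (λ n → f n + g n)
  +-isTribonacci {f} {g} tf tg n = begin
    f (3 +ℕ n) + g (3 +ℕ n)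
      ≈⟨ +-cong (tf n) (tg n) ⟩
    (f (2 +ℕ n) + f (1 +ℕ n) + f n) + (g (2 +ℕ n) + g (1 +ℕ n) + g n)
      ≈⟨ solve 6 (λ f₂ f₁ f₀ g₂ g₁ g₀ →
             (f₂ :+ f₁ :+ f₀) :+ (g₂ :+ g₁ :+ g₀) := (f₂ :+ g₂) :+ (f₁ :+ g₁) :+ (f₀ :+ g₀))
           refl (f (2 +ℕ n)) (f (1 +ℕ n)) (f n) (g (2 +ℕ n)) (g (1 +ℕ n)) (g n) ⟩
    (f (2 +ℕ n) + g (2 +ℕ n)) + (f (1 +ℕ n) + g (1 +ℕ n)) + (f n + g n) ∎

  pow-isTribonacci : ∀ {x} → x * (x * x) ≈ x * x + x + 1# → IsTribonacci (pow x)
  pow-isTribonacci {x} x³≈x²+x+1 n = begin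
    x * (x * (x * t))            ≈⟨ solve 2 (λ x t → x :* (x :* (x :* t)) := (x :* (x :* x)) :* t) refl x t ⟩
    (x * (x * x)) * t            ≈⟨ *-congʳ x³≈x²+x+1 ⟩
    (x * x + x + 1#) * t         ≈⟨ solve 2 (λ x t → (x :* x :+ x :+ con 1) :* t := x :* (x :* t) :+ x :* t :+ t)
                                      refl x t ⟩
    x * (x * t) + x * t + t      ∎
    where t = pow x n

  tribonacci-unique : ∀ {f g} → IsTribonacci f → IsTribonacci g →
                      f 0 ≈ g 0 → f 1 ≈ g 1 → f 2 ≈ g 2 → ∀ n → f n ≈ g n
  tribonacci-unique tf tg f₀≈g₀ f₁≈g₁ f₂≈g₂ zero                = f₀≈g₀
  tribonacci-unique tf tg f₀≈g₀ f₁≈g₁ f₂≈g₂ (suc zero)          = f₁≈g₁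
  tribonacci-unique tf tg f₀≈g₀ f₁≈g₁ f₂≈g₂ (suc (suc zero))    = f₂≈g₂
  tribonacci-unique tf tg f₀≈g₀ f₁≈g₁ f₂≈g₂ (suc (suc (suc n))) = begin
    _ ≈⟨ tf n ⟩
    _ ≈⟨ +-cong (+-cong (rec (suc (suc n))) (rec (suc n))) (rec n) ⟩
    _ ≈⟨ tg n ⟨
    _ ∎
    where rec = tribonacci-unique tf tg f₀≈g₀ f₁≈g₁ f₂≈g₂

  module PowerSums (α β γ : Carrier) where

    p : ℕ → Carrier
    p n = pow α n + pow β n + pow γ n

    e₁ e₂ e₃ : Carrier
    e₁ = α + β + γ
    e₂ = α * β + α * γ + β * γ
    e₃ = α * β * γ

    p₁≈e₁ : p 1 ≈ e₁
    p₁≈e₁ = +-cong (+-cong (*-identityʳ α) (*-identityʳ β)) (*-identityʳ γ)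

    p₂+2e₂≈e₁² : p 2 + e₂ * (1# + 1#) ≈ e₁ * e₁
    p₂+2e₂≈e₁² = solve 3 (λ α β γ →
        α :* (α :* con 1) :+ β :* (β :* con 1) :+ γ :* (γ :* con 1)
          :+ (α :* β :+ α :* γ :+ β :* γ) :* (con 1 :+ con 1)
        := (α :+ β :+ γ) :* (α :+ β :+ γ)) refl α β γ

    α-vieta : α * (α * α) + e₂ * α ≈ e₁ * (α * α) + e₃
    α-vieta = solve 3 (λ α β γ →
        α :* (α :* α) :+ (α :* β :+ α :* γ :+ β :* γ) :* α
        := (α :+ β :+ γ) :* (α :* α) :+ α :* β :* γ) refl α β γ

    β-vieta : β * (β * β) + e₂ * β ≈ e₁ * (β * β) + e₃
    β-vieta = solve 3 (λ α β γ →
        β :* (β :* β) :+ (α :* β :+ α :* γ :+ β :* γ) :* β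
        := (α :+ β :+ γ) :* (β :* β) :+ α :* β :* γ) refl α β γ

    γ-vieta : γ * (γ * γ) + e₂ * γ ≈ e₁ * (γ * γ) + e₃
    γ-vieta = solve 3 (λ α β γ →
        γ :* (γ :* γ) :+ (α :* β :+ α :* γ :+ β :* γ) :* γ
        := (α :+ β :+ γ) :* (γ :* γ) :+ α :* β :* γ) refl α β γ

    product-identity : ∀ a b c A B C →
      (a * A + b * B + c * C) * (a * A * a + b * B * b + c * C * c) + a * b * c * (A * B + A * C + B * C)
        ≈ (a * A * (a * A) * a + b * B * (b * B) * b + c * C * (c * C) * c)
          + (a + b + c) * (a * A * (b * B) + a * A * (c * C) + b * B * (c * C))
    product-identity = solve 6 (λ a b c A B C →
      (a :* A :+ b :* B :+ c :* C) :* (a :* A :* a :+ b :* B :* b :+ c :* C :* c)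
        :+ a :* b :* c :* (A :* B :+ A :* C :+ B :* C)
      := (a :* A :* (a :* A) :* a :+ b :* B :* (b :* B) :* b :+ c :* C :* (c :* C) :* c)
           :+ (a :+ b :+ c) :* (a :* A :* (b :* B) :+ a :* A :* (c :* C) :+ b :* B :* (c :* C))) refl

    p-product : ∀ m k → let n = m +ℕ k in
      p n * p (n +ℕ m) + pow e₃ m * C α β γ k ≈ p (2 *ℕ n +ℕ m) + p m * C α β γ n
    p-product m k = begin
      p n * p (n +ℕ m) + pow e₃ m * C α β γ k
        ≈⟨ +-cong (*-cong (expand-p n split) (expand-p (n +ℕ m) split-n+m))
                  (*-congʳ (trans (pow-distrib-* (α * β) γ m) (*-congʳ (pow-distrib-* α β m)))) ⟩
      _ ≈⟨ product-identity (pow α m) (pow β m) (pow γ m) (pow α k) (pow β k) (pow γ k) ⟩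
      _ ≈⟨ +-cong (expand-p (2 *ℕ n +ℕ m) split-2n+m)
                  (*-congˡ (+-cong (+-cong (*-cong (split α) (split β)) (*-cong (split α) (split γ)))
                                   (*-cong (split β) (split γ)))) ⟨
      p (2 *ℕ n +ℕ m) + p m * C α β γ n ∎
      where
      n = m +ℕ k

      expand-p : ∀ {f : Carrier → Carrier} i → (∀ x → pow x i ≈ f x) → p i ≈ f α + f β + f γ
      expand-p i e = +-cong (+-cong (e α) (e β)) (e γ)

      split : ∀ x → pow x n ≈ pow x m * pow x k
      split x = pow-+ x m k

      split-n+m : ∀ x → pow x (n +ℕ m) ≈ pow x m * pow x k * pow x m
      split-n+m x = trans (pow-+ x n m) (*-congʳ (split x))

      split-2n+m : ∀ x → pow x (2 *ℕ n +ℕ m) ≈ pow x m * pow x k * (pow x m * pow x k) * pow x m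
      split-2n+m x = begin
        pow x (n +ℕ (n +ℕ 0) +ℕ m)      ≈⟨ pow-+ x (n +ℕ (n +ℕ 0)) m ⟩
        pow x (n +ℕ (n +ℕ 0)) * pow x m ≈⟨ *-congʳ (pow-+ x n (n +ℕ 0)) ⟩
        pow x n * pow x (n +ℕ 0) * pow x m
          ≈⟨ *-congʳ (*-cong (split x) (trans (reflexive (≡.cong (pow x) (ℕₚ.+-identityʳ n))) (split x))) ⟩
        _ ∎

    module TribonacciRoots (e₁≈1 : e₁ ≈ 1#) (e₂≈-1 : e₂ ≈ - 1#) (e₃≈1 : e₃ ≈ 1#) where

      x≈[x+e₂y]+y : ∀ x y → x ≈ (x + e₂ * y) + y
      x≈[x+e₂y]+y x y = begin
        x                   ≈⟨ +-identityʳ x ⟨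
        x + 0#              ≈⟨ +-congˡ (-‿inverseˡ y) ⟨
        x + (- y + y)       ≈⟨ +-congˡ (+-congʳ (trans (*-congʳ e₂≈-1) (-1*x≈-x y))) ⟨
        x + (e₂ * y + y)    ≈⟨ +-assoc x (e₂ * y) y ⟨
        (x + e₂ * y) + y    ∎

      tribonacci-root : ∀ {x} → x * (x * x) + e₂ * x ≈ e₁ * (x * x) + e₃ → x * (x * x) ≈ x * x + x + 1#
      tribonacci-root {x} vieta = begin
        x * (x * x)                      ≈⟨ x≈[x+e₂y]+y (x * (x * x)) x ⟩
        (x * (x * x) + e₂ * x) + x       ≈⟨ +-congʳ (trans vieta (+-cong (*-congʳ e₁≈1) e₃≈1)) ⟩
        (1# * (x * x) + 1#) + x          ≈⟨ solve 1 (λ x → (con 1 :* (x :* x) :+ con 1) :+ x := x :* x :+ x :+ con 1)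
                                              refl x ⟩
        x * x + x + 1#                   ∎

      p₂≈3 : p 2 ≈ 1# + 1# + 1#
      p₂≈3 = begin
        p 2                                ≈⟨ x≈[x+e₂y]+y (p 2) (1# + 1#) ⟩
        (p 2 + e₂ * (1# + 1#)) + (1# + 1#) ≈⟨ +-congʳ (trans p₂+2e₂≈e₁² (*-cong e₁≈1 e₁≈1)) ⟩
        1# * 1# + (1# + 1#)                ≈⟨ solve 0 (con 1 :* con 1 :+ (con 1 :+ con 1) := con 1 :+ con 1 :+ con 1) refl ⟩
        1# + 1# + 1#                       ∎

      S≈p : ∀ n → S n ≈ p n
      S≈p = tribonacci-unique S-isTribonacci p-isTribonacci refl (sym (trans p₁≈e₁ e₁≈1)) (sym p₂≈3)
        where
        p-isTribonacci : IsTribonacci p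
        p-isTribonacci = +-isTribonacci (+-isTribonacci (pow-isTribonacci (tribonacci-root α-vieta))
                                                        (pow-isTribonacci (tribonacci-root β-vieta)))
                                        (pow-isTribonacci (tribonacci-root γ-vieta))

      S-product : ∀ m k → let n = m +ℕ k in
        S n * S (n +ℕ m) ≈ S (2 *ℕ n +ℕ m) + S m * C α β γ n - C α β γ k
      S-product m k = x+z≈y⇒x≈y-z (begin
        S n * S (n +ℕ m) + C α β γ k
          ≈⟨ +-cong (*-cong (S≈p n) (S≈p (n +ℕ m)))
                    (sym (trans (*-congʳ (trans (pow-congˡ m e₃≈1) (pow-1# m))) (*-identityˡ _))) ⟩
        p n * p (n +ℕ m) + pow e₃ m * C α β γ k
          ≈⟨ p-product m k ⟩
        p (2 *ℕ n +ℕ m) + p m * C α β γ n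
          ≈⟨ +-cong (S≈p (2 *ℕ n +ℕ m)) (*-congʳ (S≈p m)) ⟨
        S (2 *ℕ n +ℕ m) + S m * C α β γ n ∎)
        where n = m +ℕ k

mainTheorem3 : ∀ {c ℓ : Level} (R : CommutativeRing c ℓ) →
    let open CommutativeRing R
        open Tribonacci R
    in (α β γ : Carrier) →
       α + β + γ ≈ 1# →
       α * β + α * γ + β * γ ≈ - 1# →
       α * β * γ ≈ 1# →
       (n m : ℕ) → m ≤ n →
       S n * S (n +ℕ m) ≈ S (2 *ℕ n +ℕ m) + S m * C α β γ n - C α β γ (n ∸ m)
mainTheorem3 R α β γ e₁≈1 e₂≈-1 e₃≈1 n m m≤n with ℕₚ.m≤n⇒∃[o]m+o≡n m≤n
... | k , ≡.refl rewrite ℕₚ.m+n∸m≡n m k = S-product m k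
  where open TribonacciIdentities.PowerSums.TribonacciRoots R α β γ e₁≈1 e₂≈-1 e₃≈1
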